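{- Let $n$ be a positive integer, $a,b$ positive integers with $a$ even, and $p\equiv3\pmod4$ a prime with $2\nmid v_p(n)$. Then $I_p=\{0,1/2\}$.
   Context: $\mathfrak X=\operatorname{Spec}\mathbb{Z}[X,Y,Z]/(X^2+Y^2+Z^{ab}-n^a)$; $\mathfrak X(\mathbb{Z}_p)$ is the set of solutions in $\mathbb{Z}_p^3$. For $u\in\mathbb{Q}_p^\times$, $(u,-1)_p=1$ if $u$ is a sum of two squares in $\mathbb{Q}_p$, else $-1$. Let $g(Z)=\sum_{i=0}^{a-1}n^{a-1-i}Z^{ib}$. $A$ is the Azumaya algebra on $\mathfrak X_\mathbb{Q}$ given by the quaternion algebra $(n-Z^b,-1)$ on $D(n-Z^b)$ and $(g(Z),-1)$ on $D(g(Z))$, glued via $i\mapsto(Xi'+Yi'j')/g(Z)$, $j\mapsto j'$; for $P=(x,y,z)\in\mathfrak X(\mathbb{Q}_p)$, $\operatorname{inv}_pA(P)\in\{0,1/2\}$ is $0$ iff $(n-z^b,-1)_p=1$ when $n\neq z^b$, and $0$ iff $(g(z),-1)_p=1$ when $g(z)\neq0$. $I_p=\{\operatorname{inv}_pA(P)\mid P\in\mathfrak X(\mathbb{Z}_p)\}$. -}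

module Defs where

open import Data.Nat as ℕ using (ℕ; zero; suc)
open import Data.Integer as ℤ using (ℤ; +_; _+_; _*_; _-_; -_)
open import Data.Integer.Divisibility.Signed using (_∣_; divides; ∣m∣n⇒∣m+n; ∣n⇒∣m*n; ∣m⇒∣m*n; ∣m⇒∣-m)
open import Data.Integer.Tactic.RingSolver using (solve-∀)
open import Data.Product using (Σ; ∃; _×_; _,_)
open import Data.Sum using (_⊎_)
open import Relation.Binary.PropositionalEquality using (_≡_; subst; sym)
open import Relation.Nullary using (¬_)
open import Data.Nat.Divisibility using () renaming (_∣_ to _∣ℕ_)

-- ℤ_p as the inverse limit  lim ℤ/p^k ℤ : sequences of integers (x_k)
-- with x_{k+1} ≡ x_k (mod p^k); two such are equal iff x_k ≡ y_k (mod p^k)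
-- for every k.

record ℤ[_] (p : ℕ) : Set where
  constructor mkℤp
  field
    seq : ℕ → ℤ
    coh : ∀ k → + (p ℕ.^ k) ∣ (seq (suc k) - seq k)
open ℤ[_] public

module _ {p : ℕ} where

  infix 4 _≈ₚ_
  _≈ₚ_ : ℤ[ p ] → ℤ[ p ] → Set
  x ≈ₚ y = ∀ k → + (p ℕ.^ k) ∣ (seq x k - seq y k)

  private
    lemAdd : ∀ a b c d → (a + c) - (b + d) ≡ (a - b) + (c - d)
    lemAdd = solve-∀
    lemMul : ∀ a b c d → (a * c) - (b * d) ≡ a * (c - d) + (a - b) * d
    lemMul = solve-∀
    lemNeg : ∀ a b → (- a) - (- b) ≡ - (a - b)
    lemNeg = solve-∀

  infixl 6 _+ₚ_
  infixl 7 _*ₚ_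
  _+ₚ_ : ℤ[ p ] → ℤ[ p ] → ℤ[ p ]
  x +ₚ y = mkℤp (λ k → seq x k + seq y k)
    (λ k → subst (_ ∣_) (sym (lemAdd (seq x (suc k)) (seq x k) (seq y (suc k)) (seq y k)))
                 (∣m∣n⇒∣m+n (coh x k) (coh y k)))

  _*ₚ_ : ℤ[ p ] → ℤ[ p ] → ℤ[ p ]
  x *ₚ y = mkℤp (λ k → seq x k * seq y k)
    (λ k → subst (_ ∣_) (sym (lemMul (seq x (suc k)) (seq x k) (seq y (suc k)) (seq y k)))
                 (∣m∣n⇒∣m+n (∣n⇒∣m*n (seq x (suc k)) (coh y k)) (∣m⇒∣m*n (seq y k) (coh x k))))

  -ₚ_ : ℤ[ p ] → ℤ[ p ]
  -ₚ x = mkℤp (λ k → - seq x k)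
    (λ k → subst (_ ∣_) (sym (lemNeg (seq x (suc k)) (seq x k))) (∣m⇒∣-m (coh x k)))

  infixl 6 _-ₚ_
  _-ₚ_ : ℤ[ p ] → ℤ[ p ] → ℤ[ p ]
  x -ₚ y = x +ₚ (-ₚ y)

  private
    lemConst : ∀ a b → a - a ≡ + 0 * b
    lemConst = solve-∀

  ι : ℤ → ℤ[ p ]
  ι a = mkℤp (λ _ → a) (λ k → divides (+ 0) (lemConst a (+ (p ℕ.^ k))))


  0ₚ 1ₚ : ℤ[ p ]
  0ₚ = ι (+ 0)
  1ₚ = ι (+ 1)

  infixr 8 _^ₚ_
  _^ₚ_ : ℤ[ p ] → ℕ → ℤ[ p ]
  x ^ₚ zero    = 1ₚ
  x ^ₚ (suc m) = x *ₚ (x ^ₚ m)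

-- ℚ_p = ℤ_p[1/p]: a pair (x , m) stands for x / p^m.

record ℚ[_] (p : ℕ) : Set where
  constructor _/p^_
  field
    num : ℤ[ p ]
    den : ℕ
open ℚ[_] public

module _ {p : ℕ} where

  private
    π : ℕ → ℤ[ p ]
    π m = ι (+ (p ℕ.^ m))

  infix 4 _≈q_
  _≈q_ : ℚ[ p ] → ℚ[ p ] → Set
  (x /p^ m) ≈q (y /p^ m′) = π m′ *ₚ x ≈ₚ π m *ₚ y

  infixl 6 _+q_
  infixl 7 _*q_
  _+q_ : ℚ[ p ] → ℚ[ p ] → ℚ[ p ]
  (x /p^ m) +q (y /p^ m′) = (π m′ *ₚ x +ₚ π m *ₚ y) /p^ (m ℕ.+ m′)

  _*q_ : ℚ[ p ] → ℚ[ p ] → ℚ[ p ]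
  (x /p^ m) *q (y /p^ m′) = (x *ₚ y) /p^ (m ℕ.+ m′)

  ⟦_⟧ : ℤ[ p ] → ℚ[ p ]
  ⟦ u ⟧ = u /p^ 0

  -- u is a sum of two squares in ℚ_p, i.e. the Hilbert symbol (u,-1)_p = 1
  SumOfTwoSquaresℚ : ℚ[ p ] → Set
  SumOfTwoSquaresℚ u = Σ ℚ[ p ] λ s → Σ ℚ[ p ] λ t → s *q s +q t *q t ≈q u

data Sign : Set where
  one minusOne : Sign

module _ {p : ℕ} where

  HilbertSymbolIs : ℚ[ p ] → Sign → Set
  HilbertSymbolIs u one = ¬ (u ≈q ⟦ 0ₚ ⟧) × SumOfTwoSquaresℚ u
  HilbertSymbolIs u minusOne = ¬ (u ≈q ⟦ 0ₚ ⟧) × ¬ SumOfTwoSquaresℚ u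

data Inv : Set where
  0ᵢ ½ᵢ : Inv

signOf : Inv → Sign
signOf 0ᵢ = one
signOf ½ᵢ = minusOne

module _ (p n a b : ℕ) where

  private
    nₚ : ℤ[ p ]
    nₚ = ι (+ n)

  record Point : Set where
    constructor ⟨_,_,_∣_⟩
    field
      x y z : ℤ[ p ]
      onX   : x ^ₚ 2 +ₚ y ^ₚ 2 +ₚ z ^ₚ (a ℕ.* b) ≈ₚ nₚ ^ₚ a

  gSum : ℤ[ p ] → ℕ → ℤ[ p ]
  gSum z zero    = 0ₚ
  gSum z (suc i) = gSum z i +ₚ nₚ ^ₚ (a ℕ.∸ 1 ℕ.∸ i) *ₚ z ^ₚ (i ℕ.* b)

  g : ℤ[ p ] → ℤ[ p ]
  g z = gSum z a

  -- inv_p A(P) = v : computed on the chart D(n - Z^b) or on D(g(Z)),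
  -- whichever contains P (inv v = 0 iff the Hilbert symbol is 1).
  InvIs : Point → Inv → Set
  InvIs P v = HilbertSymbolIs ⟦ nₚ -ₚ Point.z P ^ₚ b ⟧ (signOf v)
            ⊎ HilbertSymbolIs ⟦ g (Point.z P) ⟧ (signOf v)

  _∈I : Inv → Set
  v ∈I = Σ Point λ P → InvIs P v

Valuation : (p n k : ℕ) → Set
Valuation p n k = (p ℕ.^ k) ∣ℕ n × ¬ ((p ℕ.^ suc k) ∣ℕ n)

module Submission where

-- Both values are witnessed on the chart D(n − Z^b), where inv_p A is read off
-- from the Hilbert symbol (n − z^b, −1)_p.
--   * 1/2: at (n^(a/2), 0, 0) we get n − z^b = n, which has odd valuation; since
--     −1 is not a square mod p (Fermat's little theorem), a descent on the
--     valuation shows that n is not a sum of two squares in ℚ_p.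
--   * 0: at (r, t, 1) we get n − z^b = n − 1.  As p ∣ n, both n^a − 1 and n − 1
--     are sums of two squares in ℤ_p: by pigeonhole s² + t² ≡ −1 (mod p), and the
--     root s of N − 1 − t² modulo p lifts to ℤ_p by Hensel's lemma.

module Elementary where

  open import Data.Nat
  open import Data.Nat.Properties
  open import Data.Nat.Divisibility
  open import Data.Nat.Primality using (Prime; euclidsLemma)
  open import Data.Nat.DivMod using (_/_; _%_; m≡m%n+[m/n]*n; m%n<n)
  open import Data.Nat.Combinatorics using (_C_; nC1≡n; nCn≡1; nCk+nC[k+1]≡[n+1]C[k+1])
  open import Data.Nat.Tactic.RingSolver using (solve-∀)
  open import Data.Fin as Fin using (Fin; toℕ; inject₁; fromℕ; fromℕ<; splitAt; join)
  open import Data.Fin.Properties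
    using (toℕ-inject₁; toℕ-fromℕ; toℕ<n; toℕ-fromℕ<; toℕ-injective; toℕ≤pred[n]; join-splitAt; pigeonhole) renaming (<⇒≢ to <⇒≢ᶠ)
  open import Data.Vec.Functional using (Vector; init; tail)
  open import Data.Product using (Σ; _,_; proj₁; proj₂; _×_)
  open import Data.Sum using (_⊎_; inj₁; inj₂; [_,_]′; reduce; fromInj₂)
  open import Data.Empty using (⊥-elim)
  open import Function using (_∘′_)
  open import Relation.Nullary using (¬_; yes; no; contradiction)
  open import Relation.Nullary.Decidable using (decidable-stable)
  open import Relation.Binary.PropositionalEquality
  open import Relation.Binary.Definitions using (tri<; tri≈; tri>)
  open import Algebra.Definitions.RawSemiring +-*-rawSemiring
    using (sum) renaming (_×_ to _·_; _^_ to _^ᵃ_)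
  open import Algebra.Properties.Monoid.Sum +-0-monoid using (sum-init-last)
  open import Algebra.Properties.CommutativeSemiring.Binomial +-*-commutativeSemiring
    using (theorem)

  absorption : ∀ n k → suc k * (suc n C suc k) ≡ suc n * (n C k)
  absorption n zero = trans (*-identityˡ (suc n C 1)) (trans (nC1≡n (suc n)) (sym (*-identityʳ (suc n))))
  absorption zero (suc k) = *-zeroʳ (suc (suc k))
  absorption (suc n) (suc k) = begin
      suc (suc k) * (suc (suc n) C suc (suc k))
    ≡⟨ cong (suc (suc k) *_) (nCk+nC[k+1]≡[n+1]C[k+1] (suc n) (suc k)) ⟨
      suc (suc k) * (X + Y)
    ≡⟨ regroup k X Y ⟩
      X + (suc k * X + suc (suc k) * Y)
    ≡⟨ cong (X +_) (cong₂ _+_ (absorption n k) (absorption n (suc k))) ⟩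
      X + (suc n * (n C k) + suc n * (n C suc k))
    ≡⟨ cong (X +_) (*-distribˡ-+ (suc n) (n C k) (n C suc k)) ⟨
      X + suc n * (n C k + n C suc k)
    ≡⟨ cong (λ u → X + suc n * u) (nCk+nC[k+1]≡[n+1]C[k+1] n k) ⟩
      suc (suc n) * X ∎
    where
    open ≡-Reasoning
    X = suc n C suc k
    Y = suc n C suc (suc k)
    regroup : ∀ k X Y → suc (suc k) * (X + Y) ≡ X + (suc k * X + suc (suc k) * Y)
    regroup = solve-∀

  -- The binomial theorem of the library is stated for an arbitrary semiring, with
  -- multiples c · x and powers x ^ᵃ n defined generically; on ℕ they are * and ^.
  ·≡* : ∀ c x → c · x ≡ c * x
  ·≡* zero x = refl
  ·≡* (suc c) x = cong (x +_) (·≡* c x)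

  ^ᵃ≡^ : ∀ x n → x ^ᵃ n ≡ x ^ n
  ^ᵃ≡^ x zero = refl
  ^ᵃ≡^ x (suc n) = cong (x *_) (^ᵃ≡^ x n)

  ∣sum : ∀ {d n} (t : Vector ℕ n) → (∀ i → d ∣ t i) → d ∣ sum t
  ∣sum {d} {zero} t h = d ∣0
  ∣sum {n = suc n} t h = ∣m∣n⇒∣m+n (h Fin.zero) (∣sum (tail t) (λ i → h (Fin.suc i)))

  -- Odd exponents 2j+1, defined by recursion so that x ^ odd (suc j) unfolds twice.
  odd : ℕ → ℕ
  odd zero = 1
  odd (suc j) = suc (suc (odd j))

  odd≡ : ∀ j → odd j ≡ suc (j + j)
  odd≡ zero = refl
  odd≡ (suc j) = cong (suc ∘′ suc) (trans (odd≡ j) (sym (+-suc j j)))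

  ∣power-odd : ∀ p i → p ∣ p ^ odd i
  ∣power-odd p i = subst (λ e → p ∣ p ^ e) (sym (odd≡ i)) (m∣m*n (p ^ (i + i)))

  ¬2∣⇒odd : ∀ k → ¬ 2 ∣ k → Σ ℕ λ j → k ≡ odd j
  ¬2∣⇒odd zero ¬2∣k = contradiction (2 ∣0) ¬2∣k
  ¬2∣⇒odd (suc zero) ¬2∣k = 0 , refl
  ¬2∣⇒odd (suc (suc k)) ¬2∣k with ¬2∣⇒odd k (λ 2∣k → ¬2∣k (∣m∣n⇒∣m+n (∣-refl {2}) 2∣k))
  ... | j , k≡ = suc j , cong (suc ∘′ suc) k≡

  ∣oddPowerSum : ∀ {d} j x y → d ∣ x + y → d ∣ x ^ odd j + y ^ odd j
  ∣oddPowerSum zero x y d∣x+y rewrite *-identityʳ x | *-identityʳ y = d∣x+y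
  ∣oddPowerSum {d} (suc j) x y d∣x+y =
    ∣m+n∣m⇒∣n (subst (d ∣_) (expand x y (x ^ odd j) (y ^ odd j)) (∣m⇒∣m*n _ d∣x+y))
              (∣n⇒∣m*n (x * y) (∣oddPowerSum j x y d∣x+y))
    where
    expand : ∀ x y X Y → (x + y) * (x * X + y * Y) ≡ x * y * (X + Y) + (x * (x * X) + y * (y * Y))
    expand = solve-∀

  -- Throughout, p = m + 2 is prime; this form makes p − 1 = m + 1 and p − 2 = m
  -- available definitionally (and p ≥ 2 evident).
  module PrimeModulus (m : ℕ) (isPrime : Prime (2 + m)) where

    p : ℕ
    p = 2 + m

    prime∤ : ∀ {k} → 0 < k → k < p → ¬ p ∣ k
    prime∤ {suc k} _ k<p p∣k = <⇒≱ k<p (∣⇒≤ p∣k)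

    prime∣binomial : ∀ k → suc k < p → p ∣ p C suc k
    prime∣binomial k k<p with euclidsLemma (suc k) (p C suc k) isPrime
                                (divides (suc m C k) (trans (absorption (suc m) k) (*-comm p (suc m C k))))
    ... | inj₁ p∣k = contradiction p∣k (prime∤ z<s k<p)
    ... | inj₂ p∣C = p∣C

    ∣-cancel-unit : ∀ {a b} → ¬ p ∣ a → p ∣ a * b → p ∣ b
    ∣-cancel-unit {a} {b} p∤a p∣ab = fromInj₂ (λ p∣a → contradiction p∣a p∤a) (euclidsLemma a b isPrime p∣ab)

    freshman : ∀ a → Σ ℕ λ q → (a + 1) ^ p ≡ a ^ p + 1 + q * p
    freshman a = q , (begin
        (a + 1) ^ p                                      ≡⟨ ^ᵃ≡^ (a + 1) p ⟨
        (a + 1) ^ᵃ p                                     ≡⟨ theorem p a 1 ⟩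
        t Fin.zero + sum (tail t)                        ≡⟨ cong (t Fin.zero +_) (sum-init-last (tail t)) ⟩
        t Fin.zero + (sum (init (tail t)) + t (fromℕ p)) ≡⟨ cong₂ (λ u v → u + (v + t (fromℕ p))) first (_∣_.equality middle) ⟩
        1 + (q * p + t (fromℕ p))                        ≡⟨ cong (λ u → 1 + (q * p + u)) last ⟩
        1 + (q * p + a ^ p)                              ≡⟨ rearrange (a ^ p) (q * p) ⟩
        a ^ p + 1 + q * p                                ∎)
      where
      open ≡-Reasoning
      t : Vector ℕ (suc p)
      t k = (p C toℕ k) · (a ^ᵃ toℕ k * 1 ^ᵃ (p ∸ toℕ k))
      term : ∀ k → t k ≡ (p C toℕ k) * (a ^ toℕ k * 1 ^ (p ∸ toℕ k))
      term k = trans (·≡* (p C toℕ k) _)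
                     (cong₂ (λ u v → (p C toℕ k) * (u * v)) (^ᵃ≡^ a (toℕ k)) (^ᵃ≡^ 1 (p ∸ toℕ k)))
      first : t Fin.zero ≡ 1
      first = trans (term Fin.zero) (cong (λ u → 1 * (1 * u)) (^-zeroˡ p))
      last : t (fromℕ p) ≡ a ^ p
      last = trans (term (fromℕ p)) (subst (λ j → (p C j) * (a ^ j * 1 ^ (p ∸ j)) ≡ a ^ p) (sym (toℕ-fromℕ p)) top)
        where
        top : (p C p) * (a ^ p * 1 ^ (p ∸ p)) ≡ a ^ p
        top rewrite nCn≡1 p | n∸n≡0 p = trans (+-identityʳ _) (*-identityʳ (a ^ p))
      middle : p ∣ sum (init (tail t))
      middle = ∣sum (init (tail t)) λ i →
        subst (p ∣_) (sym (term (Fin.suc (inject₁ i))))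
          (∣m⇒∣m*n _ (prime∣binomial (toℕ (inject₁ i)) (s<s (subst (_< suc m) (sym (toℕ-inject₁ i)) (toℕ<n i)))))
      q : ℕ
      q = _∣_.quotient middle
      rearrange : ∀ x y → 1 + (y + x) ≡ x + 1 + y
      rearrange = solve-∀

    fermat : ∀ a → Σ ℕ λ q → a ^ p ≡ a + q * p
    fermat zero = 0 , refl
    fermat (suc a) = q₁ + q₂ , (begin
        suc a ^ p               ≡⟨ cong (_^ p) (+-comm 1 a) ⟩
        (a + 1) ^ p             ≡⟨ proj₂ (freshman a) ⟩
        a ^ p + 1 + q₁ * p      ≡⟨ cong (λ u → u + 1 + q₁ * p) (proj₂ (fermat a)) ⟩
        a + q₂ * p + 1 + q₁ * p ≡⟨ rearrange a q₁ q₂ p ⟩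
        suc a + (q₁ + q₂) * p   ∎)
      where
      open ≡-Reasoning
      q₁ q₂ : ℕ
      q₁ = proj₁ (freshman a)
      q₂ = proj₁ (fermat a)
      rearrange : ∀ a q₁ q₂ p → a + q₂ * p + 1 + q₁ * p ≡ suc a + (q₁ + q₂) * p
      rearrange = solve-∀

    -- For a unit a, a^(p−1) ≡ 1 (mod p): cancel a from a·(a^(p−1) − 1) ≡ 0.
    fermat-unit : ∀ a → ¬ p ∣ a → Σ ℕ λ q → a ^ suc m ≡ 1 + q * p
    fermat-unit zero p∤a = contradiction (p ∣0) p∤a
    fermat-unit a@(suc _) p∤a =
      _∣_.quotient p∣a^[p−1]−1 , trans (sym (m+[n∸m]≡n (m^n>0 a (suc m)))) (cong (1 +_) (_∣_.equality p∣a^[p−1]−1))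
      where
      q : ℕ
      q = proj₁ (fermat a)
      a[a^[p−1]−1]≡ : a * (a ^ suc m ∸ 1) ≡ q * p
      a[a^[p−1]−1]≡ = begin
        a * (a ^ suc m ∸ 1)     ≡⟨ *-distribˡ-∸ a (a ^ suc m) 1 ⟩
        a ^ p ∸ a * 1           ≡⟨ cong₂ _∸_ (proj₂ (fermat a)) (*-identityʳ a) ⟩
        (a + q * p) ∸ a         ≡⟨ m+n∸m≡n a (q * p) ⟩
        q * p                   ∎
        where open ≡-Reasoning
      p∣a^[p−1]−1 : p ∣ a ^ suc m ∸ 1
      p∣a^[p−1]−1 = ∣-cancel-unit p∤a (divides q a[a^[p−1]−1]≡)

    -- With p − 1 = 2·(2t+1), p ∣ a² + b² would give
    -- 0 ≡ (a²)^(2t+1) + (b²)^(2t+1) = a^(p−1) + b^(p−1) ≡ 2 (mod p).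
    ∤sumOfUnitSquares : p % 4 ≡ 3 → ∀ {a b} → ¬ p ∣ a → ¬ p ∣ b → ¬ p ∣ a * a + b * b
    ∤sumOfUnitSquares p≡3 {a} {b} p∤a p∤b p∣a²+b² = 3+4t≰2 (subst (_≤ 2) p≡3+4t (∣⇒≤ p∣2))
      where
      t : ℕ
      t = p / 4
      p≡3+4t : p ≡ 3 + t * 4
      p≡3+4t = trans (m≡m%n+[m/n]*n p 4) (cong (_+ t * 4) p≡3)
      3+4t≰2 : ¬ 3 + t * 4 ≤ 2
      3+4t≰2 (s≤s (s≤s ()))
      p-1≡ : suc m ≡ 2 * odd t
      p-1≡ = cong pred (trans p≡3+4t (cong suc (shape t)))
        where
        shape : ∀ t → 2 + t * 4 ≡ 2 * odd t
        shape t rewrite odd≡ t = double t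
          where
          double : ∀ t → 2 + t * 4 ≡ 2 * suc (t + t)
          double = solve-∀
      square^odd : ∀ x → (x * x) ^ odd t ≡ x ^ suc m
      square^odd x = begin
        (x * x) ^ odd t   ≡⟨ cong (λ u → (x * u) ^ odd t) (*-identityʳ x) ⟨
        (x ^ 2) ^ odd t   ≡⟨ ^-*-assoc x 2 (odd t) ⟩
        x ^ (2 * odd t)   ≡⟨ cong (x ^_) p-1≡ ⟨
        x ^ suc m         ∎
        where open ≡-Reasoning
      qa qb : ℕ
      qa = proj₁ (fermat-unit a p∤a)
      qb = proj₁ (fermat-unit b p∤b)
      sum≡ : (a * a) ^ odd t + (b * b) ^ odd t ≡ (qa + qb) * p + 2
      sum≡ = trans (cong₂ _+_ (trans (square^odd a) (proj₂ (fermat-unit a p∤a)))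
                              (trans (square^odd b) (proj₂ (fermat-unit b p∤b))))
                   (collect qa qb p)
        where
        collect : ∀ x y p → (1 + x * p) + (1 + y * p) ≡ (x + y) * p + 2
        collect = solve-∀
      p∣2 : p ∣ 2
      p∣2 = ∣m+n∣m⇒∣n (subst (p ∣_) sum≡ (∣oddPowerSum t (a * a) (b * b) p∣a²+b²)) (n∣m*n (qa + qb))

    ∣sumOfSquares⇒∣ : p % 4 ≡ 3 → ∀ a b → p ∣ a * a + b * b → p ∣ a
    ∣sumOfSquares⇒∣ p≡3 a b p∣a²+b² =
      decidable-stable (p ∣? a) λ p∤a → ∤sumOfUnitSquares p≡3 p∤a (p∤b p∤a) p∣a²+b²
      where
      -- if p divided b, it would divide a² and hence a
      p∤b : ¬ p ∣ a → ¬ p ∣ b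
      p∤b p∤a p∣b = p∤a (reduce (euclidsLemma a a isPrime p∣a²))
        where
        p∣a² : p ∣ a * a
        p∣a² = ∣m+n∣m⇒∣n (subst (p ∣_) (+-comm (a * a) (b * b)) p∣a²+b²) (∣m⇒∣m*n b p∣b)

    -- Congruence modulo p, in the additive form x + A·p = y + B·p (no subtraction in ℕ).
    infix 4 _≡ₚ_
    _≡ₚ_ : ℕ → ℕ → Set
    x ≡ₚ y = Σ ℕ λ A → Σ ℕ λ B → x + A * p ≡ y + B * p

    ≡ₚ-sym : ∀ {x y} → x ≡ₚ y → y ≡ₚ x
    ≡ₚ-sym (A , B , e) = B , A , sym e

    residue : ℕ → Fin p
    residue x = fromℕ< (m%n<n x p)

    residue-≡ : ∀ x y → residue x ≡ residue y → x ≡ₚ y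
    residue-≡ x y e = y / p , x / p , (begin
        x + (y / p) * p                         ≡⟨ cong (_+ (y / p) * p) (m≡m%n+[m/n]*n x p) ⟩
        (x % p + (x / p) * p) + (y / p) * p     ≡⟨ cong (λ u → (u + (x / p) * p) + (y / p) * p) x%p≡y%p ⟩
        (y % p + (x / p) * p) + (y / p) * p     ≡⟨ swap (y % p) ((x / p) * p) ((y / p) * p) ⟩
        (y % p + (y / p) * p) + (x / p) * p     ≡⟨ cong (_+ (x / p) * p) (m≡m%n+[m/n]*n y p) ⟨
        y + (x / p) * p                         ∎)
      where
      open ≡-Reasoning
      x%p≡y%p : x % p ≡ y % p
      x%p≡y%p = trans (sym (toℕ-fromℕ< (m%n<n x p))) (trans (cong toℕ e) (toℕ-fromℕ< (m%n<n y p)))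
      swap : ∀ a b c → (a + b) + c ≡ (a + c) + b
      swap = solve-∀

    -- For p = 2q + 1, some s² + t² + 1 is divisible by p: the q + 1 squares x²,
    -- 0 ≤ x ≤ q, are pairwise incongruent, and so are the q + 1 numbers −1 − y²;
    -- as 2q + 2 > p, by the pigeonhole principle some x² ≡ −1 − y² (mod p).
    module OddPrime (q : ℕ) (p≡2q+1 : p ≡ suc (q + q)) where

      ≤q⇒<p : ∀ {x} → x ≤ q → x < p
      ≤q⇒<p {x} x≤q = subst (x <_) (sym p≡2q+1) (s≤s (≤-trans x≤q (m≤m+n q q)))

      -- for x < y ≤ q, write y = x + 1 + d: then p ∤ y² − x² = (d + 1)(x + y),
      -- as both factors lie strictly between 0 and p
      squares-incongruent : ∀ {x y} → x < y → y ≤ q → ¬ (x * x ≡ₚ y * y)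
      squares-incongruent {x} x<y y≤q (B , A , e) with m≤n⇒∃[o]m+o≡n x<y
      ... | d , refl =
        [ prime∤ z<s (≤q⇒<p (≤-trans (s≤s (m≤n+m d x)) y≤q)) , prime∤ 0<x+y x+y<p ]′
          (euclidsLemma (suc d) (x + y) isPrime p∣[y−x][x+y])
        where
        y : ℕ
        y = suc x + d
        expand : ∀ x d A p → (suc x + d) * (suc x + d) + A * p ≡ x * x + (suc d * (x + (suc x + d)) + A * p)
        expand = solve-∀
        p∣[y−x][x+y] : p ∣ suc d * (x + y)
        p∣[y−x][x+y] = ∣m+n∣m⇒∣n (divides B (trans (+-comm (A * p) _)
                                    (sym (+-cancelˡ-≡ (x * x) _ _ (trans e (expand x d A p))))))
                                  (n∣m*n A)
        0<x+y : 0 < x + y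
        0<x+y = ≤-trans (s≤s z≤n) (m≤n+m y x)
        x+y<p : x + y < p
        x+y<p = subst (x + y <_) (sym p≡2q+1)
                  (s≤s (+-mono-≤ (≤-trans (≤-trans (n≤1+n x) (m≤m+n (suc x) d)) y≤q) y≤q))

      squares-injective : ∀ {x y} → x ≤ q → y ≤ q → x * x ≡ₚ y * y → x ≡ y
      squares-injective {x} {y} x≤q y≤q x²≡y² with <-cmp x y
      ... | tri≈ _ x≡y _ = x≡y
      ... | tri< x<y _ _ = ⊥-elim (squares-incongruent x<y y≤q x²≡y²)
      ... | tri> _ _ y<x = ⊥-elim (squares-incongruent y<x x≤q (≡ₚ-sym x²≡y²))

      -- the reflection y ↦ p² − (1 + y²) represents −(1 + y²) modulo p
      reflect : ℕ → ℕ
      reflect y = p * p ∸ suc (y * y)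

      reflect+ : ∀ {y} → y ≤ q → reflect y + suc (y * y) ≡ p * p
      reflect+ y≤q = m∸n+n≡m (*-mono-< (≤q⇒<p y≤q) (≤q⇒<p y≤q))

      complements : ∀ {P u v s t a b} → u + s ≡ P → v + t ≡ P → u + a ≡ v + b → t + a ≡ s + b
      complements {P} {u} {v} {s} {t} {a} {b} u+s≡P v+t≡P e = +-cancelˡ-≡ P _ _ (begin
          P + (t + a)          ≡⟨ cong (_+ (t + a)) u+s≡P ⟨
          (u + s) + (t + a)    ≡⟨ shuffle₁ u s t a ⟩
          (u + a) + (s + t)    ≡⟨ cong (_+ (s + t)) e ⟩
          (v + b) + (s + t)    ≡⟨ shuffle₂ v b s t ⟩
          (v + t) + (s + b)    ≡⟨ cong (_+ (s + b)) v+t≡P ⟩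
          P + (s + b)          ∎)
        where
        open ≡-Reasoning
        shuffle₁ : ∀ u s t a → (u + s) + (t + a) ≡ (u + a) + (s + t)
        shuffle₁ = solve-∀
        shuffle₂ : ∀ v b s t → (v + b) + (s + t) ≡ (v + t) + (s + b)
        shuffle₂ = solve-∀

      reflections-injective : ∀ {x y} → x ≤ q → y ≤ q → reflect x ≡ₚ reflect y → x ≡ y
      reflections-injective {x} {y} x≤q y≤q (A , B , e) =
        sym (squares-injective {y} {x} y≤q x≤q (A , B , suc-injective
          (complements {p * p} {reflect x} {reflect y} {suc (x * x)} {suc (y * y)} (reflect+ x≤q) (reflect+ y≤q) e)))

      square≡reflection : ∀ {x y} → y ≤ q → x * x ≡ₚ reflect y → p ∣ x * x + y * y + 1
      square≡reflection {x} {y} y≤q (A , B , e) = ∣m+n∣m⇒∣n (divides (p + B) (begin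
          A * p + (x * x + y * y + 1)       ≡⟨ regroup (x * x) (y * y) (A * p) ⟩
          (x * x + A * p) + suc (y * y)     ≡⟨ cong (_+ suc (y * y)) e ⟩
          (reflect y + B * p) + suc (y * y) ≡⟨ swap (reflect y) (B * p) (suc (y * y)) ⟩
          (reflect y + suc (y * y)) + B * p ≡⟨ cong (_+ B * p) (reflect+ y≤q) ⟩
          p * p + B * p                     ≡⟨ *-distribʳ-+ p p B ⟨
          (p + B) * p                       ∎)) (n∣m*n A)
        where
        open ≡-Reasoning
        regroup : ∀ X Y Z → Z + (X + Y + 1) ≡ (X + Z) + suc Y
        regroup = solve-∀
        swap : ∀ a b c → (a + b) + c ≡ (a + c) + b
        swap = solve-∀

      candidate : Fin (suc q) ⊎ Fin (suc q) → ℕ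
      candidate (inj₁ x) = toℕ x * toℕ x
      candidate (inj₂ y) = reflect (toℕ y)

      collision : ∀ u v → u ≢ v → residue (candidate u) ≡ residue (candidate v) →
                  Σ ℕ λ s → Σ ℕ λ t → p ∣ s * s + t * t + 1
      collision u@(inj₁ x) v@(inj₁ y) u≢v e = ⊥-elim (u≢v (cong inj₁ (toℕ-injective
        (squares-injective (toℕ≤pred[n] x) (toℕ≤pred[n] y) (residue-≡ (candidate u) (candidate v) e)))))
      collision u@(inj₁ x) v@(inj₂ y) _ e =
        toℕ x , toℕ y , square≡reflection {toℕ x} (toℕ≤pred[n] y) (residue-≡ (candidate u) (candidate v) e)
      collision v@(inj₂ y) u@(inj₁ x) _ e =
        toℕ x , toℕ y , square≡reflection {toℕ x} (toℕ≤pred[n] y) (residue-≡ (candidate u) (candidate v) (sym e))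
      collision u@(inj₂ x) v@(inj₂ y) u≢v e = ⊥-elim (u≢v (cong inj₂ (toℕ-injective
        (reflections-injective (toℕ≤pred[n] x) (toℕ≤pred[n] y) (residue-≡ (candidate u) (candidate v) e)))))

      minusOne-sumOfSquares : Σ ℕ λ s → Σ ℕ λ t → p ∣ s * s + t * t + 1
      minusOne-sumOfSquares =
        let i , j , i<j , e = pigeonhole p<2q+2 (λ i → residue (candidate (splitAt (suc q) i)))
        in collision (splitAt (suc q) i) (splitAt (suc q) j) (splitAt-≢ (<⇒≢ᶠ i<j)) e
        where
        p<2q+2 : p < suc q + suc q
        p<2q+2 = subst (_< suc q + suc q) (sym p≡2q+1) (s≤s (≤-reflexive (sym (+-suc q q))))
        splitAt-≢ : ∀ {i j} → i ≢ j → splitAt (suc q) i ≢ splitAt (suc q) j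
        splitAt-≢ {i} {j} i≢j e = i≢j (begin
          i                                  ≡⟨ join-splitAt (suc q) (suc q) i ⟨
          join (suc q) (suc q) (splitAt (suc q) i) ≡⟨ cong (join (suc q) (suc q)) e ⟩
          join (suc q) (suc q) (splitAt (suc q) j) ≡⟨ join-splitAt (suc q) (suc q) j ⟩
          j                                  ∎)
          where open ≡-Reasoning

      prime∤2 : ¬ p ∣ 2
      prime∤2 p∣2 = odd≢even q (trans (cong suc (sym (n≤0⇒n≡0 (≤-pred (≤-pred (∣⇒≤ p∣2))))))
                                      (suc-injective p≡2q+1))
        where
        odd≢even : ∀ q → 1 ≢ q + q
        odd≢even zero ()
        odd≢even (suc q) e = contradiction (trans (suc-injective e) (+-suc q q)) λ ()

      -- one of s, t is a unit (else p ∣ 1); order them so that s is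
      minusOne-unitSumOfSquares : Σ ℕ λ s → Σ ℕ λ t → ¬ p ∣ s × p ∣ s * s + t * t + 1
      minusOne-unitSumOfSquares with minusOne-sumOfSquares
      ... | s , t , p∣ with p ∣? s
      ... | no p∤s = s , t , p∤s , p∣
      ... | yes p∣s = t , s , p∤t , subst (p ∣_) (cong (_+ 1) (+-comm (s * s) (t * t))) p∣
        where
        p∤t : ¬ p ∣ t
        p∤t p∣t = prime∤ z<s (s≤s (s≤s z≤n)) (∣m+n∣m⇒∣n p∣ (∣m∣n⇒∣m+n (∣m⇒∣m*n s p∣s) (∣m⇒∣m*n t p∣t)))

  -- a number ≡ 3 (mod 4) is odd: p = 2q + 1 with q = 2(p div 4) + 1
  3mod4⇒odd : ∀ p → p % 4 ≡ 3 → Σ ℕ λ q → p ≡ suc (q + q)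
  3mod4⇒odd p p≡3 = suc (t + t) , trans (m≡m%n+[m/n]*n p 4) (trans (cong (_+ t * 4) p≡3) (shape t))
    where
    t : ℕ
    t = p / 4
    shape : ∀ t → 3 + t * 4 ≡ suc (suc (t + t) + suc (t + t))
    shape = solve-∀

module Integers where

  open import Data.Nat as ℕ using (ℕ; zero; suc)
  import Data.Nat.Properties as ℕ
  open import Data.Nat.Primality using (Prime)
  open import Data.Nat.Divisibility using () renaming (_∣_ to _∣ℕ_)
  open import Data.Integer hiding (suc)
  open import Data.Integer.Properties
  open import Data.Integer.Divisibility.Signed
  open import Data.Integer.Tactic.RingSolver using (solve-∀)
  open import Data.Product using (Σ; _,_; proj₁; proj₂; _×_)
  open import Relation.Nullary using (¬_)
  open import Relation.Binary.PropositionalEquality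
  open Elementary using (odd; module PrimeModulus)
  open import Defs using (ℤ[_]; mkℤp; seq)

  pos-^ : ∀ n k → + (n ℕ.^ k) ≡ (+ n) ^ k
  pos-^ n zero = refl
  pos-^ n (suc k) = trans (pos-* n (n ℕ.^ k)) (cong ((+ n) *_) (pos-^ n k))

  ∣-difference : ∀ {d A B} → d ∣ A - B → d ∣ B → d ∣ A
  ∣-difference {d} {A} {B} d∣A-B d∣B = subst (d ∣_) (cancel A B) (∣m∣n⇒∣m+n d∣A-B d∣B)
    where
    cancel : ∀ A B → A - B + B ≡ A
    cancel = solve-∀

  *-pres-∣ : ∀ {a b c d} → a ∣ b → c ∣ d → a * c ∣ b * d
  *-pres-∣ {a} {b} {c} {d} a∣b c∣d = ∣-trans (*-monoˡ-∣ c a∣b) (*-monoʳ-∣ b c∣d)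

  ^-suc-∣ : ∀ π k → π ^ k ∣ π ^ suc k
  ^-suc-∣ π k = ∣n⇒∣m*n π ∣-refl

  π∣π^suc : ∀ π e → π ∣ π ^ suc e
  π∣π^suc π e = ∣m⇒∣m*n (π ^ e) ∣-refl

  -- Newton's iteration r ↦ r − h·(r² − c), with a
  -- fixed inverse h of 2r₀ modulo p, keeps the invariant p^(k+1) ∣ r_k² − c and
  -- r_k ≡ r₀ (mod p); the iterates then form a p-adic integer whose square is c.
  module Hensel (p : ℕ) (c r₀ h : ℤ) (r₀-root : + p ∣ r₀ * r₀ - c)
                (h-inverse : + p ∣ (r₀ + r₀) * h - 1ℤ) where

    π : ℤ
    π = + p

    r : ℕ → ℤ
    r zero = r₀
    r (suc k) = r k - h * (r k * r k - c)

    newton-error : ∀ r h c → (r - h * (r * r - c)) * (r - h * (r * r - c)) - c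
                             ≡ (1ℤ - (r + r) * h) * (r * r - c) + h * h * ((r * r - c) * (r * r - c))
    newton-error = solve-∀

    inverse-persists : ∀ r → π ∣ r - r₀ → π ∣ 1ℤ - (r + r) * h
    inverse-persists r π∣r-r₀ =
      subst (π ∣_) (regroup r r₀ h) (∣m∣n⇒∣m-n (∣m⇒∣-m h-inverse) (∣m⇒∣m*n (h + h) π∣r-r₀))
      where
      regroup : ∀ r r₀ h → - ((r₀ + r₀) * h - 1ℤ) - (r - r₀) * (h + h) ≡ 1ℤ - (r + r) * h
      regroup = solve-∀

    -- the invariant: the new error (1 − 2r_k h)·E + h²E² gains a factor p over E
    invariant : ∀ k → (π ^ suc k ∣ r k * r k - c) × (π ∣ r k - r₀)
    invariant zero = subst (_∣ r₀ * r₀ - c) (sym (*-identityʳ π)) r₀-root , divides 0ℤ (cancel r₀ π)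
      where
      cancel : ∀ r₀ π → r₀ - r₀ ≡ 0ℤ * π
      cancel = solve-∀
    invariant (suc k) =
      let error-k , close-k = invariant k
          E = r k * r k - c
      in subst (π ^ suc (suc k) ∣_) (sym (newton-error (r k) h c))
           (∣m∣n⇒∣m+n (*-pres-∣ (inverse-persists (r k) close-k) error-k)
                      (∣n⇒∣m*n (h * h) (*-pres-∣ (∣-trans (π∣π^suc π k) error-k) error-k)))
         , subst (π ∣_) (regroup (r k) r₀ (h * E))
             (∣m∣n⇒∣m-n close-k (∣n⇒∣m*n h (∣-trans (π∣π^suc π k) error-k)))
      where
      regroup : ∀ r r₀ hE → (r - r₀) - hE ≡ (r - hE) - r₀
      regroup = solve-∀

    -- consecutive iterates differ by h·(r_k² − c), a multiple of p^(k+1)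
    coherent : ∀ k → + (p ℕ.^ k) ∣ r (suc k) - r k
    coherent k = subst₂ _∣_ (sym (pos-^ p k)) (step (r k) (h * (r k * r k - c)))
                   (∣m⇒∣-m (∣n⇒∣m*n h (∣-trans (^-suc-∣ π k) (proj₁ (invariant k)))))
      where
      step : ∀ r hE → - hE ≡ (r - hE) - r
      step = solve-∀

    root : ℤ[ p ]
    root = mkℤp r coherent

    root-correct : ∀ k → + (p ℕ.^ k) ∣ seq root k * seq root k - c
    root-correct k = subst (_∣ r k * r k - c) (sym (pos-^ p k)) (∣-trans (^-suc-∣ π k) (proj₁ (invariant k)))

  π∣sumOfSquares⇒π∣ : ∀ m (isPrime : Prime (2 ℕ.+ m)) → (2 ℕ.+ m) ℕ.% 4 ≡ 3 →
                      ∀ X Y → + (2 ℕ.+ m) ∣ X * X + Y * Y → + (2 ℕ.+ m) ∣ X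
  π∣sumOfSquares⇒π∣ m isPrime p≡3 X Y h =
    ∣ᵤ⇒∣ (PrimeModulus.∣sumOfSquares⇒∣ m isPrime p≡3 ∣ X ∣ ∣ Y ∣ (∣⇒∣ᵤ (subst (_ ∣_) X²+Y²≡ h)))
    where
    square : ∀ Z → Z * Z ≡ + (∣ Z ∣ ℕ.* ∣ Z ∣)
    square (+ n) = sym (pos-* n n)
    square -[1+ n ] = refl
    X²+Y²≡ : X * X + Y * Y ≡ + (∣ X ∣ ℕ.* ∣ X ∣ ℕ.+ ∣ Y ∣ ℕ.* ∣ Y ∣)
    X²+Y²≡ = trans (cong₂ _+_ (square X) (square Y)) (sym (pos-+ (∣ X ∣ ℕ.* ∣ X ∣) (∣ Y ∣ ℕ.* ∣ Y ∣)))

  module SumsOfSquares (p : ℕ) .{{_ : ℕ.NonZero p}}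
                       (π∣sumOfSquares⇒π∣ : ∀ X Y → + p ∣ X * X + Y * Y → + p ∣ X) where

    π : ℤ
    π = + p

    sumOfSquares/π² : ∀ X Y → π ∣ X * X + Y * Y → Σ ℤ λ x → Σ ℤ λ y → X * X + Y * Y ≡ (π * π) * (x * x + y * y)
    sumOfSquares/π² X Y h =
      x , y , trans (cong₂ (λ u v → u * u + v * v) (_∣_.equality π∣X) (_∣_.equality π∣Y)) (factor x y π)
      where
      π∣X : π ∣ X
      π∣X = π∣sumOfSquares⇒π∣ X Y h
      π∣Y : π ∣ Y
      π∣Y = π∣sumOfSquares⇒π∣ Y X (subst (π ∣_) (+-comm (X * X) (Y * Y)) h)
      x y : ℤ
      x = _∣_.quotient π∣X
      y = _∣_.quotient π∣Y
      factor : ∀ x y π → x * π * (x * π) + y * π * (y * π) ≡ (π * π) * (x * x + y * y)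
      factor = solve-∀

    π∣sum : ∀ e {S} c → π ^ suc (suc e) ∣ S - π ^ suc e * c → π ∣ S
    π∣sum e c h = ∣-difference (∣-trans (π∣π^suc π (suc e)) h) (∣m⇒∣m*n c (π∣π^suc π e))

    -- Reducing mod p gives p ∣ X² + Y², so X² + Y² = p²(x² + y²); dividing by p²
    -- lowers j by one, and for j = 0 we reach p² ∣ p·c.
    descent : ∀ j X Y c → ¬ π ∣ c → ¬ π ^ suc (odd j) ∣ X * X + Y * Y - π ^ odd j * c
    descent zero X Y c π∤c h =
      let x , y , S≡ = sumOfSquares/π² X Y (π∣sum 0 c h)
          T = x * x + y * y
          π²∣π²T-πc : π * (π * 1ℤ) ∣ π * (π * T) - π * c
          π²∣π²T-πc = subst (π * (π * 1ℤ) ∣_) (trans (cong (λ S → S - π * 1ℤ * c) S≡) (regroup π T c)) h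
          π²∣πc : π * (π * 1ℤ) ∣ π * c
          π²∣πc = subst (π * (π * 1ℤ) ∣_) (difference (π * (π * T)) (π * c))
                    (∣m∣n⇒∣m-n (divides T (commute π T)) π²∣π²T-πc)
      in π∤c (subst (_∣ c) (*-identityʳ π) (*-cancelˡ-∣ π π²∣πc))
      where
      regroup : ∀ π T c → π * π * T - π * 1ℤ * c ≡ π * (π * T) - π * c
      regroup = solve-∀
      difference : ∀ A B → A - (A - B) ≡ B
      difference = solve-∀
      commute : ∀ π T → π * (π * T) ≡ T * (π * (π * 1ℤ))
      commute = solve-∀
    descent (suc j) X Y c π∤c h =
      let x , y , S≡ = sumOfSquares/π² X Y (π∣sum (suc (odd j)) c h)
          D = x * x + y * y - π ^ odd j * c
          π²π^[e+1]∣π²D : π * (π * π ^ suc (odd j)) ∣ π * (π * D)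
          π²π^[e+1]∣π²D = subst (_ ∣_) (trans (cong (λ S → S - π * (π * π ^ odd j) * c) S≡)
                                              (regroup π (x * x + y * y) (π ^ odd j) c)) h
      in descent j x y c π∤c (*-cancelˡ-∣ π (*-cancelˡ-∣ π π²π^[e+1]∣π²D))
      where
      regroup : ∀ π T P c → π * π * T - π * (π * P) * c ≡ π * (π * (T - P * c))
      regroup = solve-∀

  module OddPrimeModulus (m : ℕ) (isPrime : Prime (2 ℕ.+ m)) (q : ℕ) (p≡2q+1 : 2 ℕ.+ m ≡ suc (q ℕ.+ q)) where
    open PrimeModulus m isPrime using (p; fermat-unit; ∣-cancel-unit; module OddPrime)
    open OddPrime q p≡2q+1 using (prime∤2; minusOne-unitSumOfSquares)

    π : ℤ
    π = + p

    -- a unit x modulo p has the inverse x^(p−2), by Fermat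
    inverse : ∀ x → ¬ p ∣ℕ x → π ∣ + x * + (x ℕ.^ m) - 1ℤ
    inverse x p∤x = divides (+ k) (begin
        + x * + (x ℕ.^ m) - 1ℤ       ≡⟨ cong (_- 1ℤ) (pos-* x (x ℕ.^ m)) ⟨
        + (x ℕ.^ suc m) - 1ℤ         ≡⟨ cong (λ u → + u - 1ℤ) x^[p−1]≡ ⟩
        + (1 ℕ.+ k ℕ.* p) - 1ℤ       ≡⟨ cong (_- 1ℤ) (trans (pos-+ 1 (k ℕ.* p)) (cong (λ u → 1ℤ + u) (pos-* k p))) ⟩
        1ℤ + + k * π - 1ℤ            ≡⟨ cancel (+ k * π) ⟩
        + k * π                      ∎)
      where
      open ≡-Reasoning
      k : ℕ
      k = proj₁ (fermat-unit x p∤x)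
      x^[p−1]≡ : x ℕ.^ suc m ≡ 1 ℕ.+ k ℕ.* p
      x^[p−1]≡ = proj₂ (fermat-unit x p∤x)
      cancel : ∀ a → 1ℤ + a - 1ℤ ≡ a
      cancel = solve-∀

    -- If p ∣ s² + t² + 1 with p ∤ s, and p ∣ N, then s is a square root of N − 1 − t²
    -- modulo p which lifts to ℤ_p by Hensel's lemma (2s is a unit since p is odd).
    lift-root : ∀ N s t → ¬ p ∣ℕ s → p ∣ℕ s ℕ.* s ℕ.+ t ℕ.* t ℕ.+ 1 → π ∣ N →
                Σ ℤ[ p ] λ r → ∀ K → + (p ℕ.^ K) ∣ seq r K * seq r K - (N - 1ℤ - + t * + t)
    lift-root N s t p∤s p∣s²+t²+1 π∣N = Lift.root , Lift.root-correct
      where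
      p∤2s : ¬ p ∣ℕ s ℕ.+ s
      p∤2s p∣2s = p∤s (∣-cancel-unit prime∤2 (subst (p ∣ℕ_) (cong (s ℕ.+_) (sym (ℕ.+-identityʳ s))) p∣2s))
      toℤ : + (s ℕ.* s ℕ.+ t ℕ.* t ℕ.+ 1) ≡ + s * + s + + t * + t + 1ℤ
      toℤ = trans (pos-+ (s ℕ.* s ℕ.+ t ℕ.* t) 1)
                  (cong (_+ 1ℤ) (trans (pos-+ (s ℕ.* s) (t ℕ.* t)) (cong₂ _+_ (pos-* s s) (pos-* t t))))
      s-root : π ∣ + s * + s - (N - 1ℤ - + t * + t)
      s-root = subst (π ∣_) (regroup (+ s) (+ t) N) (∣m∣n⇒∣m-n (subst (π ∣_) toℤ (∣ᵤ⇒∣ p∣s²+t²+1)) π∣N)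
        where
        regroup : ∀ s t N → s * s + t * t + 1ℤ - N ≡ s * s - (N - 1ℤ - t * t)
        regroup = solve-∀
      module Lift = Hensel p (N - 1ℤ - + t * + t) (+ s) (+ ((s ℕ.+ s) ℕ.^ m)) s-root
                      (subst (λ u → π ∣ u * + ((s ℕ.+ s) ℕ.^ m) - 1ℤ) (pos-+ s s) (inverse (s ℕ.+ s) p∤2s))

    sumOfSquares-pred : ∀ N → π ∣ N →
      Σ ℤ λ t → Σ ℤ[ p ] λ r → ∀ K → + (p ℕ.^ K) ∣ seq r K * seq r K - (N - 1ℤ - t * t)
    sumOfSquares-pred N π∣N =
      let s , t , p∤s , p∣s²+t²+1 = minusOne-unitSumOfSquares in + t , lift-root N s t p∤s p∣s²+t²+1 π∣N

module PAdic where

  open import Data.Nat as ℕ using (ℕ; zero; suc)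
  open import Data.Integer hiding (suc)
  open import Data.Integer.Properties
  open import Data.Integer.Divisibility.Signed
  open import Data.Integer.Tactic.RingSolver using (solve-∀)
  open import Data.Nat.Tactic.RingSolver using () renaming (solve-∀ to ℕ-solve-∀)
  open import Data.Product using (_,_)
  open import Relation.Nullary using (¬_)
  open import Relation.Binary.PropositionalEquality
  open import Defs

  seq-^ₚ : ∀ {p} (x : ℤ[ p ]) j K → seq (x ^ₚ j) K ≡ seq x K ^ j
  seq-^ₚ x zero K = refl
  seq-^ₚ x (suc j) K = cong (seq x K *_) (seq-^ₚ x j K)

  module _ (p : ℕ) where

    point : ∀ n a b (x y z : ℤ[ p ]) →
            (∀ K → + (p ℕ.^ K) ∣ seq x K * seq x K + seq y K * seq y K + seq z K ^ (a ℕ.* b) - (+ n) ^ a) →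
            Point p n a b
    point n a b x y z h = ⟨ x , y , z ∣ (λ K → subst (_ ∣_) (level K) (h K)) ⟩
      where
      level : ∀ K → seq x K * seq x K + seq y K * seq y K + seq z K ^ (a ℕ.* b) - (+ n) ^ a
                  ≡ seq (x ^ₚ 2 +ₚ y ^ₚ 2 +ₚ z ^ₚ (a ℕ.* b)) K - seq (ι (+ n) ^ₚ a) K
      level K = sym (trans (cong₂ (λ Z N → seq x K * (seq x K * 1ℤ) + seq y K * (seq y K * 1ℤ) + Z - N)
                                  (seq-^ₚ z (a ℕ.* b) K) (seq-^ₚ (ι (+ n)) a K))
                           (unit (seq x K) (seq y K) (seq z K ^ (a ℕ.* b)) ((+ n) ^ a)))
        where
        unit : ∀ x y Z N → x * (x * 1ℤ) + y * (y * 1ℤ) + Z - N ≡ x * x + y * y + Z - N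
        unit = solve-∀

    nonzero : (u : ℤ[ p ]) {U : ℤ} → (∀ K → seq u K ≡ U) → ∀ K → ¬ + (p ℕ.^ K) ∣ U → ¬ (⟦ u ⟧ ≈q ⟦ 0ₚ ⟧)
    nonzero u {U} u≡U K p^K∤U u≈0 = p^K∤U (subst (_ ∣_) (trans (unit (seq u K)) (u≡U K)) (u≈0 K))
      where
      unit : ∀ v → + 1 * v - + 1 * + 0 ≡ v
      unit = solve-∀

    sumOfSquares : (u s t : ℤ[ p ]) →
                   (∀ K → + (p ℕ.^ K) ∣ seq s K * seq s K + seq t K * seq t K - seq u K) →
                   SumOfTwoSquaresℚ ⟦ u ⟧
    sumOfSquares u s t h = ⟦ s ⟧ , ⟦ t ⟧ , λ K → subst (_ ∣_) (unit (seq s K) (seq t K) (seq u K)) (h K)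
      where
      unit : ∀ s t u → s * s + t * t - u ≡ + 1 * (+ 1 * (s * s) + + 1 * (t * t)) - + 1 * u
      unit = solve-∀

  open Elementary using (odd; odd≡)
  open Integers using (pos-^; module SumsOfSquares)

  module OddValuation (p : ℕ) .{{_ : ℕ.NonZero p}}
                      (π∣sumOfSquares⇒π∣ : ∀ X Y → + p ∣ X * X + Y * Y → + p ∣ X) where
    open SumsOfSquares p π∣sumOfSquares⇒π∣ using (π; descent)

    -- An element of ℤ_p with constant levels c·p^(2i+1), p ∤ c, is not a sum of two
    -- squares in ℚ_p: clearing the denominators p^m₁, p^m₂ would give a sum of two
    -- squares ≡ p^(2j+1)·c modulo p^(2j+2) with j = m₁ + m₂ + i, contradicting descent.
    ¬sumOfSquares : (u : ℤ[ p ]) {c : ℤ} (i : ℕ) → (∀ K → seq u K ≡ c * π ^ odd i) → ¬ π ∣ c →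
                    ¬ SumOfTwoSquaresℚ ⟦ u ⟧
    ¬sumOfSquares u {c} i u≡ π∤c ((X /p^ m₁) , (Y /p^ m₂) , e) =
      descent j (B * x) (A * y) c π∤c (subst₂ _∣_ (pos-^ p (suc (odd j))) level (e (suc (odd j))))
      where
      j M : ℕ
      j = m₁ ℕ.+ m₂ ℕ.+ i
      M = (m₁ ℕ.+ m₁) ℕ.+ (m₂ ℕ.+ m₂)
      x y A B : ℤ
      x = seq X (suc (odd j))
      y = seq Y (suc (odd j))
      A = π ^ m₁
      B = π ^ m₂
      p^[m+m] : ∀ m → + (p ℕ.^ (m ℕ.+ m)) ≡ π ^ m * π ^ m
      p^[m+m] m = trans (pos-^ p (m ℕ.+ m)) (^-distribˡ-+-* π m m)
      p^M : + (p ℕ.^ M) ≡ (A * A) * (B * B)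
      p^M = trans (pos-^ p M) (trans (^-distribˡ-+-* π (m₁ ℕ.+ m₁) (m₂ ℕ.+ m₂))
                                     (cong₂ _*_ (^-distribˡ-+-* π m₁ m₁) (^-distribˡ-+-* π m₂ m₂)))
      odd-j : odd j ≡ M ℕ.+ odd i
      odd-j = trans (odd≡ j) (trans (split m₁ m₂ i) (cong (M ℕ.+_) (sym (odd≡ i))))
        where
        split : ∀ m₁ m₂ i → suc (m₁ ℕ.+ m₂ ℕ.+ i ℕ.+ (m₁ ℕ.+ m₂ ℕ.+ i))
                            ≡ (m₁ ℕ.+ m₁) ℕ.+ (m₂ ℕ.+ m₂) ℕ.+ suc (i ℕ.+ i)
        split = ℕ-solve-∀
      π^odd : π ^ odd j ≡ (A * A) * (B * B) * π ^ odd i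
      π^odd = begin
        π ^ odd j                     ≡⟨ cong (π ^_) odd-j ⟩
        π ^ (M ℕ.+ odd i)             ≡⟨ ^-distribˡ-+-* π M (odd i) ⟩
        π ^ M * π ^ odd i             ≡⟨ cong (_* π ^ odd i) (trans (sym (pos-^ p M)) p^M) ⟩
        (A * A) * (B * B) * π ^ odd i ∎
        where open ≡-Reasoning
      -- the level suc (odd j) of the equation (X/p^m₁)² + (Y/p^m₂)² = u, denominators cleared
      level : + 1 * (+ (p ℕ.^ (m₂ ℕ.+ m₂)) * (x * x) + + (p ℕ.^ (m₁ ℕ.+ m₁)) * (y * y)) - + (p ℕ.^ M) * seq u (suc (odd j))
              ≡ (B * x) * (B * x) + (A * y) * (A * y) - π ^ odd j * c
      level = begin
          + 1 * (+ (p ℕ.^ (m₂ ℕ.+ m₂)) * (x * x) + + (p ℕ.^ (m₁ ℕ.+ m₁)) * (y * y)) - + (p ℕ.^ M) * seq u (suc (odd j))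
        ≡⟨ cong₂ _-_ (cong₂ (λ P Q → + 1 * (P * (x * x) + Q * (y * y))) (p^[m+m] m₂) (p^[m+m] m₁))
                     (cong₂ _*_ p^M (u≡ (suc (odd j)))) ⟩
          + 1 * ((B * B) * (x * x) + (A * A) * (y * y)) - (A * A) * (B * B) * (c * π ^ odd i)
        ≡⟨ regroup A B x y c (π ^ odd i) ⟩
          (B * x) * (B * x) + (A * y) * (A * y) - (A * A) * (B * B) * π ^ odd i * c
        ≡⟨ cong (λ P → (B * x) * (B * x) + (A * y) * (A * y) - P * c) π^odd ⟨
          (B * x) * (B * x) + (A * y) * (A * y) - π ^ odd j * c ∎
        where
        open ≡-Reasoning
        regroup : ∀ A B x y c P → + 1 * ((B * B) * (x * x) + (A * A) * (y * y)) - (A * A) * (B * B) * (c * P)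
                                  ≡ (B * x) * (B * x) + (A * y) * (A * y) - (A * A) * (B * B) * P * c
        regroup = solve-∀

module Invariant where

  open import Data.Nat as ℕ using (ℕ; zero; suc)
  open import Data.Nat.Divisibility using (divides; ∣1⇒≡1) renaming (_∣_ to _∣ℕ_)
  import Data.Nat.Properties as ℕ
  import Data.Nat.Divisibility as ℕ
  open import Data.Nat.Primality using (Prime)
  open import Data.Integer hiding (suc)
  open import Data.Integer.Properties
  open import Data.Integer.Divisibility.Signed
  open import Data.Integer.Tactic.RingSolver using (solve-∀)
  open import Data.Product using (_,_)
  open import Data.Sum using (inj₁)
  open import Relation.Nullary using (¬_)
  open import Relation.Binary.PropositionalEquality
  open import Defs
  open Elementary using (odd; module PrimeModulus)
  open Integers using (pos-^; π∣sumOfSquares⇒π∣; module OddPrimeModulus)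
  open PAdic using (seq-^ₚ; point; nonzero; sumOfSquares; module OddValuation)

  -- inv_p A = 0 is attained for every odd prime p dividing n (and a > 0): at a
  -- point (r, t, 1), where r² + t² = n^a − 1 lifts by Hensel's lemma; there
  -- n − Z^b = n − 1 is a nonzero sum of two squares r′² + t′² in ℚ_p.
  zero-attained : ∀ m (isPrime : Prime (2 ℕ.+ m)) q → 2 ℕ.+ m ≡ suc (q ℕ.+ q) →
                  ∀ n a b → 0 ℕ.< a → (2 ℕ.+ m) ∣ℕ n → _∈I (2 ℕ.+ m) n a b 0ᵢ
  zero-attained m isPrime q p≡2q+1 n a@(suc a′) b _ p∣n = P , inj₁ (U≠0 , U-sumOfSquares)
    where
    open PrimeModulus m isPrime using (p)
    open OddPrimeModulus m isPrime q p≡2q+1 using (π; sumOfSquares-pred)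
    π∣n : π ∣ + n
    π∣n = ∣ᵤ⇒∣ p∣n
    P : Point p n a b
    P = let t , r , r-root = sumOfSquares-pred ((+ n) ^ a) (∣m⇒∣m*n ((+ n) ^ a′) π∣n)
        in point p n a b r (ι t) 1ₚ λ K → subst (_ ∣_) (on𝔛 (seq r K) t) (r-root K)
      where
      on𝔛 : ∀ r t → r * r - ((+ n) ^ a - 1ℤ - t * t) ≡ r * r + t * t + 1ℤ ^ (a ℕ.* b) - (+ n) ^ a
      on𝔛 r t = trans (rearrange r t ((+ n) ^ a)) (cong (λ u → r * r + t * t + u - (+ n) ^ a) (sym (^-zeroˡ (a ℕ.* b))))
        where
        rearrange : ∀ r t N → r * r - (N - 1ℤ - t * t) ≡ r * r + t * t + 1ℤ - N
        rearrange = solve-∀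
    U : ℤ[ p ]
    U = ι (+ n) -ₚ 1ₚ ^ₚ b
    U≡ : ∀ K → seq U K ≡ + n - 1ℤ
    U≡ K = cong (λ u → + n - u) (trans (seq-^ₚ 1ₚ b K) (^-zeroˡ b))
    -- p ∣ n, so p ∤ n − 1
    U≠0 : ¬ (⟦ U ⟧ ≈q ⟦ 0ₚ ⟧)
    U≠0 = nonzero p U U≡ 1 λ p∣n-1 →
      p≢1 (∣1⇒≡1 (∣⇒∣ᵤ (subst (π ∣_) (cancel (+ n)) (∣m∣n⇒∣m-n π∣n (∣-trans π∣p^1 p∣n-1)))))
      where
      π∣p^1 : π ∣ + (p ℕ.^ 1)
      π∣p^1 = ∣-reflexive (cong +_ (sym (ℕ.*-identityʳ p)))
      cancel : ∀ n → n - (n - 1ℤ) ≡ 1ℤ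
      cancel = solve-∀
      p≢1 : p ≢ 1
      p≢1 ()
    U-sumOfSquares : SumOfTwoSquaresℚ ⟦ U ⟧
    U-sumOfSquares =
      let t , r , r-root = sumOfSquares-pred (+ n) π∣n
      in sumOfSquares p U r (ι t) λ K → subst (_ ∣_) (level (seq r K) t K) (r-root K)
      where
      level : ∀ r t K → r * r - (+ n - 1ℤ - t * t) ≡ r * r + t * t - seq U K
      level r t K = trans (rearrange r t (+ n - 1ℤ)) (cong (λ u → r * r + t * t - u) (sym (U≡ K)))
        where
        rearrange : ∀ r t N → r * r - (N - t * t) ≡ r * r + t * t - N
        rearrange = solve-∀

  -- inv_p A = 1/2 is attained when p ≡ 3 (mod 4), v_p(n) is odd and a is even: at
  -- the point (n^(a/2), 0, 0), n − Z^b = n is nonzero but, having odd valuation,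
  -- is not a sum of two squares in ℚ_p.
  half-attained : ∀ m (isPrime : Prime (2 ℕ.+ m)) → (2 ℕ.+ m) ℕ.% 4 ≡ 3 →
                  ∀ n a b → 0 ℕ.< a → 0 ℕ.< b → ∀ a₂ → a ≡ a₂ ℕ.* 2 →
                  ∀ i → Valuation (2 ℕ.+ m) n (odd i) → _∈I (2 ℕ.+ m) n a b ½ᵢ
  half-attained m isPrime p≡3 n a@(suc _) b@(suc _) _ _ a₂ a≡ i (divides c n≡ , p^[k+1]∤n) =
    P , inj₁ (U≠0 , U-not-sumOfSquares)
    where
    open PrimeModulus m isPrime using (p)
    open OddValuation p (π∣sumOfSquares⇒π∣ m isPrime p≡3) using (¬sumOfSquares)
    π : ℤ
    π = + p
    P : Point p n a b
    P = point p n a b (ι (+ (n ℕ.^ a₂))) 0ₚ 0ₚ λ K →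
          divides 0ℤ (cancel (+ (n ℕ.^ a₂) * + (n ℕ.^ a₂)) ((+ n) ^ a) (+ (p ℕ.^ K)) square)
      where
      square : + (n ℕ.^ a₂) * + (n ℕ.^ a₂) ≡ (+ n) ^ a
      square = trans (sym (pos-* (n ℕ.^ a₂) (n ℕ.^ a₂)))
                 (trans (cong +_ (sym (ℕ.^-distribˡ-+-* n a₂ a₂)))
                 (trans (cong (λ e → + (n ℕ.^ e)) (trans (double a₂) (sym a≡))) (pos-^ n a)))
        where
        double : ∀ a₂ → a₂ ℕ.+ a₂ ≡ a₂ ℕ.* 2
        double a₂ = trans (cong (a₂ ℕ.+_) (sym (ℕ.+-identityʳ a₂))) (ℕ.*-comm 2 a₂)
      cancel : ∀ S N Q → S ≡ N → S + 0ℤ * 0ℤ + 0ℤ - N ≡ 0ℤ * Q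
      cancel S N Q refl = solve′ S Q
        where
        solve′ : ∀ S Q → S + 0ℤ * 0ℤ + 0ℤ - S ≡ 0ℤ * Q
        solve′ = solve-∀
    U : ℤ[ p ]
    U = ι (+ n) -ₚ 0ₚ ^ₚ b
    U≡ : ∀ K → seq U K ≡ + n
    U≡ K = +-identityʳ (+ n)
    U≠0 : ¬ (⟦ U ⟧ ≈q ⟦ 0ₚ ⟧)
    U≠0 = nonzero p U U≡ (suc (odd i)) λ h → p^[k+1]∤n (∣⇒∣ᵤ h)
    n≡cπ^k : + n ≡ + c * π ^ odd i
    n≡cπ^k = trans (cong +_ n≡) (trans (pos-* c (p ℕ.^ odd i)) (cong (+ c *_) (pos-^ p (odd i))))
    π∤c : ¬ π ∣ + c
    π∤c π∣c = p^[k+1]∤n (subst (_ ∣ℕ_) (sym n≡) (ℕ.*-monoˡ-∣ (p ℕ.^ odd i) (∣⇒∣ᵤ π∣c)))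
    U-not-sumOfSquares : ¬ SumOfTwoSquaresℚ ⟦ U ⟧
    U-not-sumOfSquares = ¬sumOfSquares U i (λ K → trans (U≡ K) n≡cπ^k) π∤c

open import Defs
open import Data.Nat using (ℕ; _<_; _%_)
open import Data.Nat.Divisibility using (_∣_)
open import Data.Nat.Primality using (Prime)
open import Data.Product using (Σ; _×_)
open import Relation.Binary.PropositionalEquality using (_≡_)
open import Relation.Nullary using (¬_)
open import Data.Nat using (zero; suc)
open import Data.Nat.Divisibility using (divides; ∣-trans)
open import Data.Product using (_,_; proj₁; proj₂)
open import Relation.Binary.PropositionalEquality using (subst)
open Elementary using (odd; ¬2∣⇒odd; ∣power-odd; 3mod4⇒odd)
open Invariant using (zero-attained; half-attained)

lemma3p12 : (n a b p : ℕ) → 0 < n → 0 < a → 0 < b → 2 ∣ a →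
    Prime p → p % 4 ≡ 3 → Σ ℕ (λ k → Valuation p n k × ¬ (2 ∣ k)) →
    (v : Inv) → _∈I p n a b v
lemma3p12 n a b zero _ _ _ _ _ () _
lemma3p12 n a b (suc zero) _ _ _ _ _ () _
lemma3p12 n a b p@(suc (suc m)) _ 0<a 0<b (divides a₂ a≡) isPrime p≡3 (k , vₚ[n]≡k , k-odd) = attained
  where
  i : ℕ
  i = proj₁ (¬2∣⇒odd k k-odd)
  vₚ[n]≡2i+1 : Valuation p n (odd i)
  vₚ[n]≡2i+1 = subst (Valuation p n) (proj₂ (¬2∣⇒odd k k-odd)) vₚ[n]≡k
  q : ℕ
  q = proj₁ (3mod4⇒odd p p≡3)
  attained : (v : Inv) → _∈I p n a b v
  attained 0ᵢ = zero-attained m isPrime q (proj₂ (3mod4⇒odd p p≡3)) n a b 0<a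
                  (∣-trans (∣power-odd p i) (proj₁ vₚ[n]≡2i+1))
  attained ½ᵢ = half-attained m isPrime p≡3 n a b 0<a 0<b a₂ a≡ i vₚ[n]≡2i+1
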